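{- Let $j,k$ be integers with $k+250<j<3k/2$, $j\ge 212299$ and $k\ge 141534$. Let $G$ be a complete graph on $4j+1$ vertices whose edges are colored red and blue such that the red subgraph contains no cycle $C_{2k+1}$ and the blue subgraph contains no wheel $W_{2j}$. Let $v$ be a vertex of $G$ of maximum blue degree and let $H$ be the subgraph induced on the blue neighborhood $N^B(v)$. Let $a,b$ be vertices of $H$ joined by a red edge, each having fewer than $j$ blue neighbors in $H$. Let $C$ be a red cycle of length $2j-502$ in $H-a-b$, with vertices labeled by $\mathbb{Z}/(2j-502)\mathbb{Z}$ so that $i$ and $i+1$ are consecutive on $C$. For each label $i$ set $A_i=1$ if the edge $ai$ is red and $A_i=0$ if blue, and $B_i=1$ if $bi$ is red and $B_i=0$ if blue. Then $|\{x: A_x\neq B_{x-1}\}|\le 1000$ and $|\{x: B_x\neq A_{x-1}\}|\le 1000$.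
   Context: $C_m$ is the cycle of length $m$; the wheel $W_{n}$ consists of a cycle $C_n$ together with a hub vertex adjacent to all cycle vertices. Indices of labels are taken modulo $2j-502$. -}

module Defs where

open import Data.Nat using (ℕ; zero; suc; _<_; _<?_)
open import Data.Fin using (Fin; zero; suc; toℕ; fromℕ; fromℕ<; inject₁)
open import Data.Fin.Properties using () renaming (_≟_ to _≟ᶠ_)
open import Data.List using (List; length; filterᵇ)
open import Data.List using () renaming (allFin to allFinL)
open import Data.Bool using (Bool; true; false; _∧_; not)
open import Data.Product using (Σ; ∃; _×_; _,_)
open import Relation.Binary.PropositionalEquality using (_≡_; _≢_)
open import Relation.Nullary using (does)
open import Function.Definitions using (Injective)

data Colour : Set where
  red blue : Colour

isRed : Colour → Bool
isRed red = true
isRed blue = false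

isBlue : Colour → Bool
isBlue c = not (isRed c)

-- a 2-colouring of the edges of the complete graph K_n on vertex set Fin n:
-- a symmetric function; its values on the diagonal (loops) are never used.
record Colouring (n : ℕ) : Set where
  field
    col : Fin n → Fin n → Colour
    sym : ∀ x y → col x y ≡ col y x
open Colouring public

cycSuc : ∀ {m} → Fin m → Fin m
cycSuc {suc m} i with toℕ i <? m
... | Relation.Nullary.yes p = suc (fromℕ< p)
... | Relation.Nullary.no _ = zero

cycPred : ∀ {m} → Fin m → Fin m
cycPred {suc m} zero = fromℕ m
cycPred {suc m} (suc i) = inject₁ i

_≢ᵇ_ : ∀ {n} → Fin n → Fin n → Bool
x ≢ᵇ y = not (does (x ≟ᶠ y))

count : ∀ {n} → (Fin n → Bool) → ℕ
count {n} p = length (filterᵇ p (allFinL n))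

HasRedCycle : ∀ {n} → Colouring n → ℕ → Set
HasRedCycle {n} χ m =
  Σ (Fin m → Fin n) λ f → Injective _≡_ _≡_ f × (∀ i → col χ (f i) (f (cycSuc i)) ≡ red)

HasBlueWheel : ∀ {n} → Colouring n → ℕ → Set
HasBlueWheel {n} χ m =
  Σ (Fin n) λ h → Σ (Fin m → Fin n) λ f →
    Injective _≡_ _≡_ f × (∀ i → f i ≢ h)
    × (∀ i → col χ (f i) (f (cycSuc i)) ≡ blue)
    × (∀ i → col χ h (f i) ≡ blue)

blueDeg : ∀ {n} → Colouring n → Fin n → ℕ
blueDeg χ w = count (λ u → (u ≢ᵇ w) ∧ isBlue (col χ w u))

InNB : ∀ {n} → Colouring n → Fin n → Fin n → Set
InNB χ v u = (u ≢ v) × (col χ v u ≡ blue)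

inNBᵇ : ∀ {n} → Colouring n → Fin n → Fin n → Bool
inNBᵇ χ v u = (u ≢ᵇ v) ∧ isBlue (col χ v u)

blueDegInH : ∀ {n} → Colouring n → Fin n → Fin n → ℕ
blueDegInH χ v w = count (λ u → inNBᵇ χ v u ∧ (u ≢ᵇ w) ∧ isBlue (col χ w u))

ind : ∀ {n} → Colouring n → Fin n → Fin n → Bool
ind χ x y = isRed (col χ x y)

_≠ᵇ_ : Bool → Bool → Bool
true ≠ᵇ b = not b
false ≠ᵇ b = b

module Submission where

open import Defs renaming (sym to col-sym)
open import Data.Nat using (ℕ; zero; suc; _+_; _*_; _∸_; _≤_; _<_; z≤n; _<?_)
open import Data.Nat.Properties
  using ( +-0-commutativeMonoid; module ≤-Reasoning; ≤-refl; ≤-reflexive; ≤-trans; ≤-antisym; ≤-pred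
        ; ≤-<-trans; <⇒≤; <-irrefl; ≮⇒≥; n≤1+n; m≤n+m; +-comm; +-suc; +-identityʳ; *-identityʳ
        ; +-mono-≤; +-cancelˡ-≤; m+n∸n≡m; m≤n⇒∃[o]m+o≡n )
open import Data.Nat.GeneralisedArithmetic using (fold; fold-+)
open import Data.Nat.Tactic.RingSolver using (solve-∀)
open import Algebra.Properties.CommutativeMonoid.Sum +-0-commutativeMonoid
  using (sum; sum-syntax; ∑-distrib-+; sum-cong-≗; sum-remove; ∑-permute)
open import Data.Fin using (Fin; zero; suc; toℕ; fromℕ; inject₁; punchIn; punchOut)
open import Data.Fin.Properties
  using (toℕ-injective; toℕ<n; toℕ-fromℕ<; toℕ-fromℕ; toℕ-inject₁; punchOut-injective; punchIn-punchOut)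
  renaming (suc-injective to Fin-suc-injective; 0≢1+n to zero≢suc; _≟_ to _≟ᶠ_)
open import Data.Fin.Permutation using (permutation)
open import Data.List using (length; filterᵇ; tabulate)
open import Data.Bool using (Bool; true; false; not; _∧_)
open import Data.Product using (_×_; _,_)
open import Data.Empty using (⊥; ⊥-elim)
open import Function using (_∘_; id)
open import Function.Definitions using (Injective)
open import Relation.Binary.PropositionalEquality
open import Relation.Nullary using (yes; no; ¬_; contradiction)
open import Relation.Nullary.Decidable using (dec-false)

-- Let t = |C| − (2k − 1), so that walking 2k − 1 steps forward from i + t ends at i.  If a were red
-- to both i and i + t, that arc and a would form a red C_{2k+1}; if b were red to i and a to
-- i + t + 1, the arc from i + t + 1 to i, then b, then a would.  Hence the red neighbours of a on C
-- are never at distance t, so the positions y with A_y = A_{y+t} = 0 number 2N − |C| ≤ 500, where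
-- N < j counts the blue edges from a to C; likewise for b.  Finally every x with A_x ≠ B_{x−1} is
-- such a position for b (at x − t − 1, if A_x = 1) or for a (at x, if A_x = 0).

⟦_⟧ : Bool → ℕ
⟦ true ⟧ = 1
⟦ false ⟧ = 0

length-filterᵇ-tabulate : ∀ {A : Set} {n} (p : A → Bool) (f : Fin n → A) →
  length (filterᵇ p (tabulate f)) ≡ ∑[ i < n ] ⟦ p (f i) ⟧
length-filterᵇ-tabulate {n = zero} p f = refl
length-filterᵇ-tabulate {n = suc n} p f with p (f zero)
... | true = cong suc (length-filterᵇ-tabulate p (f ∘ suc))
... | false = length-filterᵇ-tabulate p (f ∘ suc)

count≡∑ : ∀ {n} (p : Fin n → Bool) → count p ≡ ∑[ i < n ] ⟦ p i ⟧
count≡∑ p = length-filterᵇ-tabulate p id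

∑-const : ∀ n x → ∑[ i < n ] x ≡ n * x
∑-const zero x = refl
∑-const (suc n) x = cong (x +_) (∑-const n x)

∑-mono-≤ : ∀ {n} {f g : Fin n → ℕ} → (∀ i → f i ≤ g i) → ∑[ i < n ] f i ≤ ∑[ i < n ] g i
∑-mono-≤ {zero} f≤g = z≤n
∑-mono-≤ {suc n} f≤g = +-mono-≤ (f≤g zero) (∑-mono-≤ (f≤g ∘ suc))

∑-mono-injective : ∀ {m n} {f : Fin m → ℕ} {g : Fin n → ℕ} (h : Fin m → Fin n) → Injective _≡_ _≡_ h →
  (∀ i → f i ≤ g (h i)) → ∑[ i < m ] f i ≤ ∑[ i < n ] g i
∑-mono-injective {zero} h h-inj f≤gh = z≤n
∑-mono-injective {suc m} {zero} h h-inj f≤gh with () ← h zero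
∑-mono-injective {suc m} {suc n} {f} {g} h h-inj f≤gh = begin
  f zero + ∑[ i < m ] f (suc i)            ≤⟨ +-mono-≤ (f≤gh zero) rest ⟩
  g (h zero) + ∑[ i < n ] g (punchIn (h zero) i) ≡⟨ sum-remove g ⟨
  ∑[ i < suc n ] g i ∎
  where
  open ≤-Reasoning
  h₀≢h : ∀ i → h zero ≢ h (suc i)
  h₀≢h i = zero≢suc ∘ h-inj
  h′ : Fin m → Fin n
  h′ i = punchOut (h₀≢h i)
  rest : ∑[ i < m ] f (suc i) ≤ ∑[ i < n ] g (punchIn (h zero) i)
  rest = ∑-mono-injective h′ (λ e → Fin-suc-injective (h-inj (punchOut-injective (h₀≢h _) (h₀≢h _) e)))
    (λ i → subst (λ x → f (suc i) ≤ g x) (sym (punchIn-punchOut (h₀≢h i))) (f≤gh (suc i)))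

infixl 6 _⊕_
_⊕_ : ∀ {m} → Fin m → ℕ → Fin m
x ⊕ r = fold x cycSuc r

toℕ-≮ : ∀ {m} (i : Fin (suc m)) → ¬ toℕ i < m → toℕ i ≡ m
toℕ-≮ i i≮m = ≤-antisym (≤-pred (toℕ<n i)) (≮⇒≥ i≮m)

toℕ-cycSuc-< : ∀ {m} (i : Fin (suc m)) → toℕ i < m → toℕ (cycSuc i) ≡ suc (toℕ i)
toℕ-cycSuc-< {m} i i<m with toℕ i <? m
... | yes i<m′ = cong suc (toℕ-fromℕ< i<m′)
... | no i≮m = contradiction i<m i≮m

cycSuc-≮ : ∀ {m} (i : Fin (suc m)) → ¬ toℕ i < m → cycSuc i ≡ zero
cycSuc-≮ {m} i i≮m with toℕ i <? m
... | yes i<m = contradiction i<m i≮m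
... | no _ = refl

cycPred-cycSuc : ∀ {m} (i : Fin m) → cycPred (cycSuc i) ≡ i
cycPred-cycSuc {suc m} i with toℕ i <? m
... | yes i<m = toℕ-injective (trans (toℕ-inject₁ _) (toℕ-fromℕ< i<m))
... | no i≮m = toℕ-injective (trans (toℕ-fromℕ m) (sym (toℕ-≮ i i≮m)))

cycSuc-cycPred : ∀ {m} (i : Fin m) → cycSuc (cycPred i) ≡ i
cycSuc-cycPred {suc m} zero = cycSuc-≮ (fromℕ m) (<-irrefl (toℕ-fromℕ m))
cycSuc-cycPred {suc m} (suc i) = toℕ-injective (begin
  toℕ (cycSuc (inject₁ i)) ≡⟨ toℕ-cycSuc-< (inject₁ i) (subst (_< m) (sym (toℕ-inject₁ i)) (toℕ<n i)) ⟩
  suc (toℕ (inject₁ i))    ≡⟨ cong suc (toℕ-inject₁ i) ⟩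
  suc (toℕ i)              ∎)
  where open ≡-Reasoning

cycSuc-injective : ∀ {m} → Injective _≡_ _≡_ (cycSuc {m})
cycSuc-injective {x = i} {j} e = trans (sym (cycPred-cycSuc i)) (trans (cong cycPred e) (cycPred-cycSuc j))

∑-cycSuc : ∀ {m} (f : Fin m → ℕ) → ∑[ i < m ] f (cycSuc i) ≡ ∑[ i < m ] f i
∑-cycSuc f = sym (∑-permute f (permutation cycSuc cycPred cycSuc-cycPred cycPred-cycSuc))

∑-⊕ : ∀ {m} (f : Fin m → ℕ) r → ∑[ i < m ] f (i ⊕ r) ≡ ∑[ i < m ] f i
∑-⊕ f zero = refl
∑-⊕ f (suc r) = trans (∑-⊕ (f ∘ cycSuc) r) (∑-cycSuc f)

⊕-+ : ∀ {m} (x : Fin m) r s → x ⊕ (r + s) ≡ x ⊕ s ⊕ r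
⊕-+ x r s = fold-+ x cycSuc r

⊕-comm : ∀ {m} (x : Fin m) r s → x ⊕ r ⊕ s ≡ x ⊕ s ⊕ r
⊕-comm x r s = trans (sym (⊕-+ x s r)) (trans (cong (x ⊕_) (+-comm s r)) (⊕-+ x r s))

⊕-injectiveˡ : ∀ {m} {x y : Fin m} r → x ⊕ r ≡ y ⊕ r → x ≡ y
⊕-injectiveˡ zero e = e
⊕-injectiveˡ (suc r) e = ⊕-injectiveˡ r (cycSuc-injective e)

toℕ-zero⊕ : ∀ {m} r → r ≤ m → toℕ (zero {m} ⊕ r) ≡ r
toℕ-zero⊕ zero _ = refl
toℕ-zero⊕ {m} (suc r) r<m = trans (toℕ-cycSuc-< _ (subst (_< m) (sym ih) r<m)) (cong suc ih)
  where ih = toℕ-zero⊕ r (<⇒≤ r<m)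

zero⊕toℕ : ∀ {m} (x : Fin (suc m)) → zero ⊕ toℕ x ≡ x
zero⊕toℕ x = toℕ-injective (toℕ-zero⊕ (toℕ x) (≤-pred (toℕ<n x)))

⊕-injectiveʳ : ∀ {m} (x : Fin (suc m)) {r s} → r ≤ m → s ≤ m → x ⊕ r ≡ x ⊕ s → r ≡ s
⊕-injectiveʳ x {r} {s} r≤m s≤m e = begin
  r                 ≡⟨ toℕ-zero⊕ r r≤m ⟨
  toℕ (zero ⊕ r)    ≡⟨ cong toℕ (⊕-injectiveˡ (toℕ x) (trans (shifted r) (trans e (sym (shifted s))))) ⟩
  toℕ (zero ⊕ s)    ≡⟨ toℕ-zero⊕ s s≤m ⟩
  s                 ∎
  where
  open ≡-Reasoning
  shifted : ∀ t → zero ⊕ t ⊕ toℕ x ≡ x ⊕ t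
  shifted t = trans (⊕-comm zero t (toℕ x)) (cong (_⊕ t) (zero⊕toℕ x))

⊕-period : ∀ {m} (x : Fin (suc m)) → x ⊕ suc m ≡ x
⊕-period {m} x = begin
  x ⊕ suc m                   ≡⟨ cong (_⊕ suc m) (zero⊕toℕ x) ⟨
  zero ⊕ toℕ x ⊕ suc m        ≡⟨ ⊕-comm zero (toℕ x) (suc m) ⟩
  zero ⊕ suc m ⊕ toℕ x        ≡⟨ cong (_⊕ toℕ x) (cycSuc-≮ (zero ⊕ m) (<-irrefl (toℕ-zero⊕ m ≤-refl))) ⟩
  zero ⊕ toℕ x                ≡⟨ zero⊕toℕ x ⟩
  x                           ∎
  where open ≡-Reasoning

⊕-wrap : ∀ {m} (x : Fin (suc m)) r s → r + s ≡ suc m → x ⊕ r ⊕ s ≡ x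
⊕-wrap x r s r+s≡m = trans (sym (⊕-+ x s r)) (trans (cong (x ⊕_) (trans (+-comm s r) r+s≡m)) (⊕-period x))

doubleZeros : ∀ {m} → (Fin m → Bool) → ℕ → ℕ
doubleZeros {m} X s = ∑[ y < m ] ⟦ not (X y) ∧ not (X (y ⊕ s)) ⟧

∑-doubleZeros : ∀ {m} (X : Fin m → Bool) s → (∀ y → X y ≡ true → X (y ⊕ s) ≡ true → ⊥) →
  ∑[ y < m ] ⟦ not (X y) ⟧ + ∑[ y < m ] ⟦ not (X y) ⟧ ≡ m + doubleZeros X s
∑-doubleZeros {m} X s no-two-ones = begin
  ∑[ y < m ] Z y + ∑[ y < m ] Z y          ≡⟨ cong (∑[ y < m ] Z y +_) (∑-⊕ Z s) ⟨
  ∑[ y < m ] Z y + ∑[ y < m ] Z (y ⊕ s)    ≡⟨ ∑-distrib-+ Z (Z ∘ (_⊕ s)) ⟨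
  ∑[ y < m ] (Z y + Z (y ⊕ s))             ≡⟨ sum-cong-≗ (λ y → zeros (X y) (X (y ⊕ s)) (no-two-ones y)) ⟩
  ∑[ y < m ] (1 + ⟦ D y ⟧)                 ≡⟨ ∑-distrib-+ (λ _ → 1) (λ y → ⟦ D y ⟧) ⟩
  ∑[ y < m ] 1 + doubleZeros X s           ≡⟨ cong (_+ doubleZeros X s) (trans (∑-const m 1) (*-identityʳ m)) ⟩
  m + doubleZeros X s                      ∎
  where
  open ≡-Reasoning
  Z : Fin m → ℕ
  Z y = ⟦ not (X y) ⟧
  D : Fin m → Bool
  D y = not (X y) ∧ not (X (y ⊕ s))
  zeros : ∀ x x′ → (x ≡ true → x′ ≡ true → ⊥) → ⟦ not x ⟧ + ⟦ not x′ ⟧ ≡ 1 + ⟦ not x ∧ not x′ ⟧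
  zeros true true no-two = ⊥-elim (no-two refl refl)
  zeros true false _ = refl
  zeros false true _ = refl
  zeros false false _ = refl

surplus-bound : ∀ {M N D J K} → N + N ≡ M + D → N < J → J + J ≡ M + (2 + K) → D ≤ K
surplus-bound {M} {N} {D} {J} {K} N+N≡M+D N<J J+J≡M+2+K =
  +-cancelˡ-≤ 2 D K (+-cancelˡ-≤ M (2 + D) (2 + K) (begin
  M + (2 + D)      ≡⟨ trans (+-suc M (suc D)) (cong suc (+-suc M D)) ⟩
  2 + (M + D)      ≡⟨ cong (2 +_) N+N≡M+D ⟨
  2 + (N + N)      ≡⟨ cong suc (+-suc N N) ⟨
  suc N + suc N    ≤⟨ +-mono-≤ N<J N<J ⟩
  J + J            ≡⟨ J+J≡M+2+K ⟩
  M + (2 + K)      ∎))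
  where open ≤-Reasoning

record RedPath {n} (χ : Colouring n) (L : ℕ) : Set where
  field
    vertex   : ℕ → Fin n
    distinct : ∀ {r s} → r ≤ L → s ≤ L → vertex r ≡ vertex s → r ≡ s
    red-step : ∀ {r} → r < L → col χ (vertex r) (vertex (suc r)) ≡ red
open RedPath

module _ {n} {χ : Colouring n} where

  prepend : ∀ {L} (w : Fin n) (P : RedPath χ L) →
    (∀ {r} → r ≤ L → vertex P r ≢ w) → col χ w (vertex P 0) ≡ red → RedPath χ (suc L)
  prepend {L} w P fresh w-red = record { vertex = vertex′ ; distinct = distinct′ ; red-step = red-step′ }
    where
    vertex′ : ℕ → Fin n
    vertex′ zero = w
    vertex′ (suc r) = vertex P r
    distinct′ : ∀ {r s} → r ≤ suc L → s ≤ suc L → vertex′ r ≡ vertex′ s → r ≡ s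
    distinct′ {zero} {zero} _ _ _ = refl
    distinct′ {zero} {suc s} _ s≤L e = contradiction (sym e) (fresh (≤-pred s≤L))
    distinct′ {suc r} {zero} r≤L _ e = contradiction e (fresh (≤-pred r≤L))
    distinct′ {suc r} {suc s} r≤L s≤L e = cong suc (distinct P (≤-pred r≤L) (≤-pred s≤L) e)
    red-step′ : ∀ {r} → r < suc L → col χ (vertex′ r) (vertex′ (suc r)) ≡ red
    red-step′ {zero} _ = w-red
    red-step′ {suc r} r<L = red-step P (≤-pred r<L)

  closeRedPath : ∀ {L} (P : RedPath χ L) → col χ (vertex P L) (vertex P 0) ≡ red → HasRedCycle χ (suc L)
  closeRedPath {L} P closing = vertex P ∘ toℕ , injective , edge
    where
    injective : Injective _≡_ _≡_ (vertex P ∘ toℕ)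
    injective {i} {j} e = toℕ-injective (distinct P (≤-pred (toℕ<n i)) (≤-pred (toℕ<n j)) e)
    edge : ∀ i → col χ (vertex P (toℕ i)) (vertex P (toℕ (cycSuc i))) ≡ red
    edge i with toℕ i <? L
    ... | yes i<L rewrite toℕ-cycSuc-< i i<L = red-step P i<L
    ... | no i≮L rewrite cycSuc-≮ i i≮L | toℕ-≮ i i≮L = closing

  arcPath : ∀ {m} (c : Fin (suc m) → Fin n) → Injective _≡_ _≡_ c →
    (∀ i → col χ (c i) (c (cycSuc i)) ≡ red) → (x : Fin (suc m)) (L : ℕ) → L ≤ m → RedPath χ L
  arcPath c c-inj c-red x L L≤m = record
    { vertex = λ r → c (x ⊕ r)
    ; distinct = λ r≤L s≤L e → ⊕-injectiveʳ x (≤-trans r≤L L≤m) (≤-trans s≤L L≤m) (c-inj e)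
    ; red-step = λ {r} _ → c-red (x ⊕ r)
    }

isRed⇒red : ∀ {x} → isRed x ≡ true → x ≡ red
isRed⇒red {red} _ = refl

mismatch-cases : ∀ {α β β₀ α₁} → (β₀ ≡ true → α ≡ true → ⊥) → (β ≡ true → α₁ ≡ true → ⊥) →
  ⟦ α ≠ᵇ β ⟧ ≤ ⟦ not β₀ ∧ not β ⟧ + ⟦ not α ∧ not α₁ ⟧
mismatch-cases {true} {true} _ _ = z≤n
mismatch-cases {false} {false} _ _ = z≤n
mismatch-cases {true} {false} {true} h _ = ⊥-elim (h refl refl)
mismatch-cases {true} {false} {false} _ _ = ≤-refl
mismatch-cases {false} {true} {_} {true} _ h = ⊥-elim (h refl refl)
mismatch-cases {false} {true} {β₀} {false} _ _ = m≤n+m 1 ⟦ not β₀ ∧ false ⟧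

≢ᵇ-true : ∀ {n} {x y : Fin n} → x ≢ y → (x ≢ᵇ y) ≡ true
≢ᵇ-true {x = x} {y} x≢y = cong not (dec-false (x ≟ᶠ y) x≢y)

inNB⇒inNBᵇ : ∀ {n} {χ : Colouring n} {v u} → InNB χ v u → inNBᵇ χ v u ≡ true
inNB⇒inNBᵇ (u≢v , vu-blue) = cong₂ _∧_ (≢ᵇ-true u≢v) (cong isBlue vu-blue)

blue-to-cycle≤blueDegInH : ∀ {n} {χ : Colouring n} {v w : Fin n} {M} (c : Fin M → Fin n) →
  Injective _≡_ _≡_ c → (∀ i → InNB χ v (c i)) → (∀ i → c i ≢ w) →
  ∑[ i < M ] ⟦ isBlue (col χ w (c i)) ⟧ ≤ blueDegInH χ v w
blue-to-cycle≤blueDegInH {χ = χ} {v} {w} c c-inj c∈N c≢w =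
  ≤-trans (∑-mono-injective c c-inj pointwise) (≤-reflexive (sym (count≡∑ blueNeighbourInH)))
  where
  blueNeighbourInH : Fin _ → Bool
  blueNeighbourInH u = inNBᵇ χ v u ∧ (u ≢ᵇ w) ∧ isBlue (col χ w u)
  pointwise : ∀ i → ⟦ isBlue (col χ w (c i)) ⟧ ≤ ⟦ blueNeighbourInH (c i) ⟧
  pointwise i = ≤-reflexive (sym (cong₂ (λ α β → ⟦ α ∧ β ∧ isBlue (col χ w (c i)) ⟧)
    (inNB⇒inNBᵇ {χ = χ} (c∈N i)) (≢ᵇ-true (c≢w i))))

module _ {n} {χ : Colouring n} {d p : ℕ}
  (c : Fin (suc d + suc p) → Fin n) (c-inj : Injective _≡_ _≡_ c)
  (c-red : ∀ i → col χ (c i) (c (cycSuc i)) ≡ red)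
  (no-cycle : ¬ HasRedCycle χ (3 + p)) where

  no-red-chords-at-distance : ∀ w → (∀ i → c i ≢ w) →
    ∀ y → ind χ w (c y) ≡ true → ind χ w (c (y ⊕ suc d)) ≡ true → ⊥
  no-red-chords-at-distance w c≢w y wy-red wy′-red =
    no-cycle (closeRedPath (prepend w arc (λ _ → c≢w _) (isRed⇒red wy′-red)) closing)
    where
    arc : RedPath χ (suc p)
    arc = arcPath c c-inj c-red (y ⊕ suc d) (suc p) (m≤n+m (suc p) d)
    closing : col χ (c (y ⊕ suc d ⊕ suc p)) w ≡ red
    closing rewrite ⊕-wrap y (suc d) (suc p) refl = trans (col-sym χ (c y) w) (isRed⇒red wy-red)

  module _ {a b : Fin n} (a≢b : a ≢ b) (ab-red : col χ a b ≡ red)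
    (c≢a : ∀ i → c i ≢ a) (c≢b : ∀ i → c i ≢ b) where

    no-crossed-red-chords : ∀ z → ind χ b (c z) ≡ true → ind χ a (c (z ⊕ suc (suc d))) ≡ true → ⊥
    no-crossed-red-chords z bz-red az′-red =
      no-cycle (closeRedPath (prepend b a-arc b-fresh (trans (col-sym χ b a) ab-red)) closing)
      where
      arc : RedPath χ p
      arc = arcPath c c-inj c-red (z ⊕ suc (suc d)) p (≤-trans (n≤1+n p) (m≤n+m (suc p) d))
      a-arc : RedPath χ (suc p)
      a-arc = prepend a arc (λ _ → c≢a _) (isRed⇒red az′-red)
      b-fresh : ∀ {r} → r ≤ suc p → vertex a-arc r ≢ b
      b-fresh {zero} _ = a≢b
      b-fresh {suc r} _ = c≢b _
      closing : col χ (c (z ⊕ suc (suc d) ⊕ p)) b ≡ red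
      closing rewrite ⊕-wrap z (suc (suc d)) p (cong suc (sym (+-suc d p))) =
        trans (col-sym χ (c z) b) (isRed⇒red bz-red)

    mismatches≤doubleZeros :
      ∑[ x < suc d + suc p ] ⟦ ind χ a (c x) ≠ᵇ ind χ b (c (cycPred x)) ⟧
        ≤ doubleZeros (ind χ b ∘ c) (suc d) + doubleZeros (ind χ a ∘ c) (suc d)
    mismatches≤doubleZeros = begin
      ∑[ x < M ] ⟦ A x ≠ᵇ B (cycPred x) ⟧
        ≡⟨ ∑-⊕ (λ x → ⟦ A x ≠ᵇ B (cycPred x) ⟧) (suc t) ⟨
      ∑[ z < M ] ⟦ A (z ⊕ suc t) ≠ᵇ B (cycPred (z ⊕ suc t)) ⟧
        ≡⟨ sum-cong-≗ (λ z → cong (λ y → ⟦ A (z ⊕ suc t) ≠ᵇ B y ⟧) (cycPred-cycSuc (z ⊕ t))) ⟩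
      ∑[ z < M ] ⟦ A (z ⊕ suc t) ≠ᵇ B (z ⊕ t) ⟧
        ≤⟨ ∑-mono-≤ (λ z → mismatch-cases (no-crossed-red-chords z) (crossed-at-shift z)) ⟩
      ∑[ z < M ] (⟦ DB z ⟧ + ⟦ DA (z ⊕ suc t) ⟧)
        ≡⟨ ∑-distrib-+ (λ z → ⟦ DB z ⟧) (λ z → ⟦ DA (z ⊕ suc t) ⟧) ⟩
      doubleZeros B t + ∑[ z < M ] ⟦ DA (z ⊕ suc t) ⟧
        ≡⟨ cong (doubleZeros B t +_) (∑-⊕ (λ z → ⟦ DA z ⟧) (suc t)) ⟩
      doubleZeros B t + doubleZeros A t
        ∎
      where
      open ≤-Reasoning
      M = suc d + suc p
      t = suc d
      A B : Fin M → Bool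
      A = ind χ a ∘ c
      B = ind χ b ∘ c
      DA DB : Fin M → Bool
      DA y = not (A y) ∧ not (A (y ⊕ t))
      DB y = not (B y) ∧ not (B (y ⊕ t))
      crossed-at-shift : ∀ z → B (z ⊕ t) ≡ true → A (z ⊕ suc t ⊕ t) ≡ true → ⊥
      crossed-at-shift z b-red a-red =
        no-crossed-red-chords (z ⊕ t) b-red (subst (λ y → A y ≡ true) (⊕-comm z (suc t) t) a-red)

mismatches≤1000 : ∀ {n} {χ : Colouring n} {v a b : Fin n} {M} d p J (c : Fin M → Fin n) →
  suc d + suc p ≡ M → J + J ≡ M + 502 → ¬ HasRedCycle χ (3 + p) →
  Injective _≡_ _≡_ c → (∀ i → col χ (c i) (c (cycSuc i)) ≡ red) → (∀ i → InNB χ v (c i)) →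
  (∀ i → c i ≢ a) → (∀ i → c i ≢ b) → a ≢ b → col χ a b ≡ red →
  blueDegInH χ v a < J → blueDegInH χ v b < J →
  count (λ x → ind χ a (c x) ≠ᵇ ind χ b (c (cycPred x))) ≤ 1000
mismatches≤1000 {χ = χ} {v} {a} {b} d p J c refl J+J≡M+502 no-cycle c-inj c-red c∈N c≢a c≢b a≢b ab-red
  a-deg b-deg = begin
  count mismatch                                                          ≡⟨ count≡∑ mismatch ⟩
  ∑[ x < suc d + suc p ] ⟦ mismatch x ⟧
    ≤⟨ mismatches≤doubleZeros {χ = χ} c c-inj c-red no-cycle a≢b ab-red c≢a c≢b ⟩
  doubleZeros (ind χ b ∘ c) (suc d) + doubleZeros (ind χ a ∘ c) (suc d)   ≤⟨ +-mono-≤ (bound c≢b b-deg) (bound c≢a a-deg) ⟩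
  500 + 500                                                               ∎
  where
  open ≤-Reasoning
  mismatch : Fin (suc d + suc p) → Bool
  mismatch x = ind χ a (c x) ≠ᵇ ind χ b (c (cycPred x))
  bound : ∀ {w} → (∀ i → c i ≢ w) → blueDegInH χ v w < J → doubleZeros (ind χ w ∘ c) (suc d) ≤ 500
  bound {w} c≢w w-deg = surplus-bound
    (∑-doubleZeros (ind χ w ∘ c) (suc d) (no-red-chords-at-distance {χ = χ} c c-inj c-red no-cycle w c≢w))
    (≤-<-trans (blue-to-cycle≤blueDegInH {χ = χ} {v} c c-inj c∈N c≢w) w-deg) J+J≡M+502

lemma22 : (j k : ℕ) → k + 250 < j → 2 * j < 3 * k → 212299 ≤ j → 141534 ≤ k
    → (χ : Colouring (4 * j + 1))
    → ¬ HasRedCycle χ (2 * k + 1)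
    → ¬ HasBlueWheel χ (2 * j)
    → (v : Fin (4 * j + 1)) → (∀ u → blueDeg χ u ≤ blueDeg χ v)
    → (a b : Fin (4 * j + 1)) → InNB χ v a → InNB χ v b → a ≢ b
    → col χ a b ≡ red
    → blueDegInH χ v a < j → blueDegInH χ v b < j
    → (c : Fin (2 * j ∸ 502) → Fin (4 * j + 1))
    → Injective _≡_ _≡_ c
    → (∀ i → InNB χ v (c i)) → (∀ i → c i ≢ a) → (∀ i → c i ≢ b)
    → (∀ i → col χ (c i) (c (cycSuc i)) ≡ red)
    → count (λ x → ind χ a (c x) ≠ᵇ ind χ b (c (cycPred x))) ≤ 1000
      × count (λ x → ind χ b (c x) ≠ᵇ ind χ a (c (cycPred x))) ≤ 1000
-- Here k is one less than in the paper and j = k + 252 + e, so |C| = (2e + 1) + (2k + 1).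
lemma22 j (suc k) k+250<j _ _ _ χ no-C2k+1 _ v _ a b _ _ a≢b ab-red a-deg b-deg c c-inj c∈N c≢a c≢b c-red
  with e , j≡ ← m≤n⇒∃[o]m+o≡n k+250<j =
    mismatches≤1000 {χ = χ} {v = v} (e + e) (k + k) j c M≡ J+J≡M+502 no-C2k+1′ c-inj c-red c∈N
      c≢a c≢b a≢b ab-red a-deg b-deg
  , mismatches≤1000 {χ = χ} {v = v} (e + e) (k + k) j c M≡ J+J≡M+502 no-C2k+1′ c-inj c-red c∈N
      c≢b c≢a (a≢b ∘ sym) (trans (col-sym χ b a) ab-red) b-deg a-deg
  where
  2j≡ : 2 * j ≡ suc (e + e) + suc (k + k) + 502
  2j≡ = trans (cong (2 *_) (sym j≡)) (double-j k e)
    where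
    double-j : ∀ k e → 2 * (suc (suc k + 250) + e) ≡ suc (e + e) + suc (k + k) + 502
    double-j = solve-∀
  M≡ : suc (e + e) + suc (k + k) ≡ 2 * j ∸ 502
  M≡ = trans (sym (m+n∸n≡m _ 502)) (cong (_∸ 502) (sym 2j≡))
  J+J≡M+502 : j + j ≡ 2 * j ∸ 502 + 502
  J+J≡M+502 = trans (cong (j +_) (sym (+-identityʳ j))) (trans 2j≡ (cong (_+ 502) M≡))
  no-C2k+1′ : ¬ HasRedCycle χ (3 + (k + k))
  no-C2k+1′ = no-C2k+1 ∘ subst (HasRedCycle χ) (odd k)
    where
    odd : ∀ k → 3 + (k + k) ≡ 2 * suc k + 1
    odd = solve-∀
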